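{- For every $r\ge 3$ and all integers $3\le k_0\le k_1\le \cdots \le k_{r-1}$, \[ S(r;k_0,\dots,k_{r-1}) \ge \Bigl(\prod_{j=2}^{r-1}k_j\Bigr)S(2;k_0,k_1) -\sum_{i=2}^{r-1}\prod_{j=i+1}^{r-1}k_j, \] where an empty product equals $1$. In particular, if $4\le s\le t\le k_2\le \cdots \le k_{r-1}$, then \[ S(r;s,t,k_2,\dots,k_{r-1}) \ge \Bigl(\prod_{j=2}^{r-1}k_j\Bigr)(st-t-1) -\sum_{i=2}^{r-1}\prod_{j=i+1}^{r-1}k_j. \]
   Context: For an integer $k\ge 3$, let $\mathcal{L}(k)$ denote the linear equation $x_1+x_2+\cdots+x_{k-1}=x_k$ in positive integer variables. For integers $r\ge 1$ and $k_0,\dots,k_{r-1}\ge 3$, the generalized Schur number $S(r;k_0,\dots,k_{r-1})$ is the least positive integer $N$ such that for every coloring of $[1,N]=\{1,2,\dots,N\}$ with the $r$ colors $0,1,\dots,r-1$, there is some $i\in\{0,\dots,r-1\}$ and a solution $(x_1,\dots,x_{k_i})$ of $\mathcal{L}(k_i)$ with all $x_j\in[1,N]$ colored $i$. -}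

module Defs where

open import Data.Nat using (ℕ; zero; suc; _+_; _*_; _∸_; _≤_; _<_)
open import Data.Fin using (Fin; toℕ)
open import Data.Vec using (Vec; sum)
open import Data.Vec.Relation.Unary.All using (All)
open import Data.List using (List; map; upTo)
open import Data.Nat.ListAction using (product) renaming (sum to listSum)

open import Data.Product using (Σ; _×_)
open import Relation.Binary.PropositionalEquality using (_≡_)
open import Relation.Nullary using (¬_)

InColour : {r : ℕ} → (ℕ → Fin r) → ℕ → Fin r → ℕ → Set
InColour c N i x = (1 ≤ x) × (x ≤ N) × (c x ≡ i)

-- A monochromatic (colour i) solution in [1,N] of L(k): x₁+⋯+x_{k-1} = x_k.
-- The first k-1 variables are the vector xs, the last is y.
MonoSol : {r : ℕ} → (ℕ → Fin r) → ℕ → Fin r → ℕ → Set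
MonoSol c N i k =
  Σ (Vec ℕ (k ∸ 1)) λ xs → Σ ℕ λ y →
    All (InColour c N i) xs × InColour c N i y × (sum xs ≡ y)

-- Every r-colouring of [1,N] has, for some colour i, a solution of L(k_i) in colour i.
-- (A colouring of [1,N] is represented by c : ℕ → Fin r; values outside [1,N] are irrelevant.)
SchurProp : (r : ℕ) → (Fin r → ℕ) → ℕ → Set
SchurProp r k N = (c : ℕ → Fin r) → Σ (Fin r) λ i → MonoSol c N i (k i)

IsSchurNumber : (r : ℕ) → (Fin r → ℕ) → ℕ → Set
IsSchurNumber r k N = (1 ≤ N) × SchurProp r k N × (∀ M → 1 ≤ M → M < N → ¬ SchurProp r k M)

restrict : (r : ℕ) → (ℕ → ℕ) → Fin r → ℕ
restrict r k i = k (toℕ i)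

range : ℕ → ℕ → List ℕ
range a b = map (a +_) (upTo (b ∸ a))

prodRange : (ℕ → ℕ) → ℕ → ℕ → ℕ
prodRange k a b = product (map k (range a b))

sumRange : (ℕ → ℕ) → ℕ → ℕ → ℕ
sumRange f a b = listSum (map f (range a b))

withFirstTwo : ℕ → ℕ → (ℕ → ℕ) → ℕ → ℕ
withFirstTwo s t k zero = s
withFirstTwo s t k (suc zero) = t
withFirstTwo s t k (suc (suc j)) = k (suc (suc j))

{-# OPTIONS --safe #-}
-- Let c be an m-colouring of [1, n] with no solution of L(k_i) in colour i, and let
-- K = q + 2 ≥ k_0, …, k_{m-1}.  Put o = (q + 1)(n + 1) − 1 and colour [1, n] by c,
-- the middle block (n, o] by a new colour m, and (o, o + n] by x ↦ c (x − o).
-- The new colour has no solution of L(K): q + 1 middle elements already sum past o.  An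
-- old-colour solution has at most q + 1 summands, so as (q + 1)n ≤ o its sum is in [1, n]
-- exactly when no summand is in the upper block, and in (o, o + n] exactly when one is;
-- subtracting o from the upper elements then gives a solution for c in [1, n].  Hence
-- S(m + 1) ≥ K · S(m) − 1, which iterated from S(2; k_0, k_1) gives the bound.  Starting
-- instead from the 1-colouring of [1, s − 2] gives S(2; s, t) ≥ s t − t − 1.
module Submission where

open import Defs
open import Data.Nat
  using (ℕ; zero; suc; _+_; _*_; _∸_; _≤_; _<_; _≰_; _≤′_; ≤′-refl; ≤′-step; z≤n; s≤s; _≤?_)
open import Data.Nat.Properties
import Algebra.Properties.CommutativeSemigroup as CommSemigroupProperties
open CommSemigroupProperties +-commutativeSemigroup using (x∙yz≈y∙xz)
open CommSemigroupProperties *-commutativeSemigroup using (xy∙z≈xz∙y)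
open import Data.Nat.Tactic.RingSolver using (solve-∀)
open import Data.Nat.ListAction using (product) renaming (sum to listSum)
open import Data.Nat.ListAction.Properties using (sum-++; product-++)
open import Data.Fin using (Fin; toℕ; inject₁; fromℕ; zero)
open import Data.Fin.Properties
  using (toℕ-inject₁; toℕ-fromℕ; inject₁-injective; fromℕ≢inject₁; toℕ<n)
open import Data.Fin.Relation.Unary.Top using (view; ‵fromℕ; ‵inject₁)
open import Data.List using (List; []; _∷_; upTo; _++_; [_])
import Data.List as List
open import Data.List.Properties using (map-++; upTo-∷ʳ; map-∘; map-cong-local)
import Data.List.Relation.Unary.All as ListAll
open import Data.List.Relation.Unary.All.Properties using (all-upTo)
open import Data.Vec using (Vec; []; _∷_; sum)
import Data.Vec as Vec
open import Data.Vec.Relation.Unary.All using (All; []; _∷_)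
import Data.Vec.Relation.Unary.All as All
open import Data.Vec.Relation.Unary.All.Properties using (gmap)
open import Data.Product using (Σ-syntax; _×_; _,_; proj₁; proj₂)
open import Data.Sum using (_⊎_; inj₁; inj₂)
open import Function using (_∘_)
open import Relation.Binary.PropositionalEquality
  using (_≡_; refl; sym; trans; cong; cong₂; subst; module ≡-Reasoning)
open import Relation.Nullary using (¬_; yes; no; contradiction)

m<o∸n⇒n+m<o : ∀ n o {m} → m < o ∸ n → n + m < o
m<o∸n⇒n+m<o zero    o       m<o = m<o
m<o∸n⇒n+m<o (suc n) (suc o) m<o = s≤s (m<o∸n⇒n+m<o n o m<o)

range-self : ∀ a → range a a ≡ []
range-self a rewrite n∸n≡0 a = refl

range-suc : ∀ {a b} → a ≤ b → range a (suc b) ≡ range a b ++ [ b ]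
range-suc {a} {b} a≤b = begin
  List.map (a +_) (upTo (suc b ∸ a))           ≡⟨ cong (List.map (a +_) ∘ upTo) (+-∸-assoc 1 a≤b) ⟩
  List.map (a +_) (upTo (suc (b ∸ a)))         ≡⟨ cong (List.map (a +_)) (upTo-∷ʳ (b ∸ a)) ⟨
  List.map (a +_) (upTo (b ∸ a) ++ [ b ∸ a ])  ≡⟨ map-++ (a +_) (upTo (b ∸ a)) [ b ∸ a ] ⟩
  range a b ++ [ a + (b ∸ a) ]                 ≡⟨ cong (λ x → range a b ++ [ x ]) (m+[n∸m]≡n a≤b) ⟩
  range a b ++ [ b ]                           ∎
  where open ≡-Reasoning

map-range-cong : ∀ {A : Set} {f g : ℕ → A} a b → (∀ {i} → a ≤ i → i < b → f i ≡ g i)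
  → List.map f (range a b) ≡ List.map g (range a b)
map-range-cong {f = f} {g} a b f≡g = begin
  List.map f (List.map (a +_) (upTo (b ∸ a)))  ≡⟨ map-∘ (upTo (b ∸ a)) ⟨
  List.map (f ∘ (a +_)) (upTo (b ∸ a))
    ≡⟨ map-cong-local (ListAll.map f≡g-shifted (all-upTo (b ∸ a))) ⟩
  List.map (g ∘ (a +_)) (upTo (b ∸ a))         ≡⟨ map-∘ (upTo (b ∸ a)) ⟩
  List.map g (List.map (a +_) (upTo (b ∸ a)))  ∎
  where
    open ≡-Reasoning
    f≡g-shifted : ∀ {x} → x < b ∸ a → f (a + x) ≡ g (a + x)
    f≡g-shifted {x} x<b∸a = f≡g (m≤m+n a x) (m<o∸n⇒n+m<o a b x<b∸a)

prodRange-self : ∀ k a → prodRange k a a ≡ 1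
prodRange-self k a = cong (product ∘ List.map k) (range-self a)

prodRange-suc : ∀ k {a b} → a ≤ b → prodRange k a (suc b) ≡ prodRange k a b * k b
prodRange-suc k {a} {b} a≤b = begin
  product (List.map k (range a (suc b)))             ≡⟨ cong (product ∘ List.map k) (range-suc a≤b) ⟩
  product (List.map k (range a b ++ [ b ]))          ≡⟨ cong product (map-++ k (range a b) [ b ]) ⟩
  product (List.map k (range a b) ++ [ k b ])        ≡⟨ product-++ (List.map k (range a b)) [ k b ] ⟩
  prodRange k a b * (k b * 1)                        ≡⟨ cong (prodRange k a b *_) (*-identityʳ (k b)) ⟩
  prodRange k a b * k b                              ∎
  where open ≡-Reasoning

prodRange-cong : ∀ {k k′} a b → (∀ {i} → a ≤ i → i < b → k i ≡ k′ i)
  → prodRange k a b ≡ prodRange k′ a b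
prodRange-cong a b k≡k′ = cong product (map-range-cong a b k≡k′)

sumRange-suc : ∀ f {a b} → a ≤ b → sumRange f a (suc b) ≡ sumRange f a b + f b
sumRange-suc f {a} {b} a≤b = begin
  listSum (List.map f (range a (suc b)))             ≡⟨ cong (listSum ∘ List.map f) (range-suc a≤b) ⟩
  listSum (List.map f (range a b ++ [ b ]))          ≡⟨ cong listSum (map-++ f (range a b) [ b ]) ⟩
  listSum (List.map f (range a b) ++ [ f b ])        ≡⟨ sum-++ (List.map f (range a b)) [ f b ] ⟩
  sumRange f a b + (f b + 0)                         ≡⟨ cong (sumRange f a b +_) (+-identityʳ (f b)) ⟩
  sumRange f a b + f b                               ∎
  where open ≡-Reasoning

sum-map-*ʳ : ∀ (f : ℕ → ℕ) c (xs : List ℕ)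
  → listSum (List.map (λ x → f x * c) xs) ≡ listSum (List.map f xs) * c
sum-map-*ʳ f c []       = refl
sum-map-*ʳ f c (x ∷ xs) = begin
  f x * c + listSum (List.map (λ x → f x * c) xs) ≡⟨ cong (f x * c +_) (sum-map-*ʳ f c xs) ⟩
  f x * c + listSum (List.map f xs) * c          ≡⟨ *-distribʳ-+ c (f x) (listSum (List.map f xs)) ⟨
  listSum (List.map f (x ∷ xs)) * c               ∎
  where open ≡-Reasoning

tailSum : (ℕ → ℕ) → ℕ → ℕ → ℕ
tailSum k a b = sumRange (λ i → prodRange k (i + 1) b) a b

tailSum-self : ∀ k a → tailSum k a a ≡ 0
tailSum-self k a = cong (listSum ∘ List.map _) (range-self a)

tailSum-suc : ∀ k {a b} → a ≤ b → tailSum k a (suc b) ≡ tailSum k a b * k b + 1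
tailSum-suc k {a} {b} a≤b = begin
  tailSum k a (suc b)
    ≡⟨ sumRange-suc _ a≤b ⟩
  sumRange (λ i → prodRange k (i + 1) (suc b)) a b + prodRange k (b + 1) (suc b)
    ≡⟨ cong₂ _+_ (cong listSum (map-range-cong a b (λ _ i<b → prodRange-suc k (i<b⇒i+1≤b i<b))))
                 (subst (λ c → prodRange k c (suc b) ≡ 1) (+-comm 1 b) (prodRange-self k (suc b))) ⟩
  sumRange (λ i → prodRange k (i + 1) b * k b) a b + 1
    ≡⟨ cong (_+ 1) (sum-map-*ʳ _ (k b) (range a b)) ⟩
  tailSum k a b * k b + 1
    ∎
  where
    open ≡-Reasoning
    i<b⇒i+1≤b : ∀ {i} → i < b → i + 1 ≤ b
    i<b⇒i+1≤b {i} = subst (_≤ b) (+-comm 1 i)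

tailSum-cong : ∀ {k k′} a b → (∀ {i} → a ≤ i → i < b → k i ≡ k′ i)
  → tailSum k a b ≡ tailSum k′ a b
tailSum-cong a b k≡k′ = cong listSum (map-range-cong a b λ a≤i _ →
  prodRange-cong _ b λ i+1≤j j<b → k≡k′ (≤-trans a≤i (m+n≤o⇒m≤o _ i+1≤j)) j<b)

-- The end o + n of the blown-up interval, where o = (q + 1) n + q.
blowup : ℕ → ℕ → ℕ
blowup q n = suc q * n + q + n

blowup-tailSum : ∀ q L T P n → L + 1 + T ≡ P * suc n
  → blowup q L + 1 + (T * (2 + q) + 1) ≡ P * (2 + q) * suc n
blowup-tailSum q L T P n eq = begin
  blowup q L + 1 + (T * (2 + q) + 1)  ≡⟨ factor q L T ⟩
  (L + 1 + T) * (2 + q)               ≡⟨ cong (_* (2 + q)) eq ⟩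
  P * suc n * (2 + q)                 ≡⟨ xy∙z≈xz∙y P (suc n) (2 + q) ⟩
  P * (2 + q) * suc n                 ∎
  where
    open ≡-Reasoning
    factor : ∀ q L T → suc q * L + q + L + 1 + (T * (2 + q) + 1) ≡ (L + 1 + T) * (2 + q)
    factor = solve-∀

st∸t∸1≡1+blowup : ∀ {s t} → 2 ≤ s → 2 ≤ t → s * t ∸ t ∸ 1 ≡ suc (blowup (t ∸ 2) (s ∸ 2))
st∸t∸1≡1+blowup {suc (suc p)} {suc (suc u)} (s≤s (s≤s _)) (s≤s (s≤s _)) = begin
  (2 + p) * (2 + u) ∸ (2 + u) ∸ 1  ≡⟨ cong (_∸ 1) (m+n∸m≡n (2 + u) (suc p * (2 + u))) ⟩
  suc p * (2 + u) ∸ 1              ≡⟨ cong suc (expand p u) ⟩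
  suc (blowup u p)                 ∎
  where
    open ≡-Reasoning
    expand : ∀ p u → u + p * (2 + u) ≡ suc u * p + u + p
    expand = solve-∀

*-≤-sum : ∀ {a l} (xs : Vec ℕ l) → All (a ≤_) xs → l * a ≤ sum xs
*-≤-sum []       []         = z≤n
*-≤-sum (x ∷ xs) (a≤x ∷ ps) = +-mono-≤ a≤x (*-≤-sum xs ps)

InColour-mono : ∀ {r} {c : ℕ → Fin r} {N N′ i x}
  → N ≤ N′ → InColour c N i x → InColour c N′ i x
InColour-mono N≤N′ (1≤x , x≤N , cx≡i) = 1≤x , ≤-trans x≤N N≤N′ , cx≡i

SchurProp-mono : ∀ {r K N N′} → N ≤ N′ → SchurProp r K N → SchurProp r K N′
SchurProp-mono N≤N′ S c with S c
... | i , xs , y , xs-i , y-i , sum≡y =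
  i , xs , y , All.map (InColour-mono {c = c} N≤N′) xs-i , InColour-mono {c = c} N≤N′ y-i , sum≡y

¬SchurProp⇒< : ∀ {r K L N} → ¬ SchurProp r K L → SchurProp r K N → L < N
¬SchurProp⇒< {r} {K} {L} {N} ¬S S with N ≤? L
... | yes N≤L = contradiction (SchurProp-mono {r} {K} N≤L S) ¬S
... | no  N≰L = ≰⇒> N≰L

¬SchurProp-zero : ∀ {r K} → ¬ SchurProp (suc r) K 0
¬SchurProp-zero S with S (λ _ → zero)
... | _ , _ , _ , _ , (1≤y , y≤0 , _) , _ = <⇒≱ 1≤y y≤0

IsSchurNumber⇒¬SchurProp-pred : ∀ {r K M} → IsSchurNumber (suc r) K (suc M) → ¬ SchurProp (suc r) K M
IsSchurNumber⇒¬SchurProp-pred {K = K} {M = zero} _ = ¬SchurProp-zero {K = K}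
IsSchurNumber⇒¬SchurProp-pred {M = suc M} (_ , _ , minimal) = minimal (suc M) (s≤s z≤n) ≤-refl

¬SchurProp-single : ∀ {q} (K : Fin 1 → ℕ) → K zero ≡ 2 + q → ¬ SchurProp 1 K q
¬SchurProp-single {q} K K≡2+q S with S (λ _ → zero)
... | zero , sol with subst (MonoSol (λ _ → zero) q zero) K≡2+q sol
...   | xs , y , xs-pos , (_ , y≤q , _) , sum≡y =
  <⇒≱ (≤-trans (≤-reflexive (sym (*-identityʳ (suc q)))) (*-≤-sum xs (All.map proj₁ xs-pos)))
      (subst (_≤ q) (sym sum≡y) y≤q)

module Fold (n o : ℕ) where
  open ≡-Reasoning

  fold : ℕ → ℕ
  fold x with x ≤? n
  ... | yes _ = x
  ... | no  _ = x ∸ o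

  fold-low : ∀ {x} → x ≤ n → fold x ≡ x
  fold-low {x} x≤n with x ≤? n
  ... | yes _   = refl
  ... | no  x≰n = contradiction x≤n x≰n

  fold-high : ∀ {x} → x ≰ n → fold x ≡ x ∸ o
  fold-high {x} x≰n with x ≤? n
  ... | yes x≤n = contradiction x≤n x≰n
  ... | no  _   = refl

  Outer : ℕ → Set
  Outer x = x ≤ n ⊎ o < x

  data SumShape {l} (xs : Vec ℕ l) : Set where
    no-high   : sum xs ≤ l * n → sum (Vec.map fold xs) ≡ sum xs → SumShape xs
    one-high  : o < sum xs → sum xs ≡ o + sum (Vec.map fold xs) → SumShape xs
    many-high : suc o + suc o ≤ sum xs → SumShape xs

  sumShape : ∀ {l} (xs : Vec ℕ l) → All Outer xs → SumShape xs
  sumShape []       []                 = no-high z≤n refl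
  sumShape (x ∷ xs) (x-outer ∷ xs-outer) with x ≤? n | x-outer | sumShape xs xs-outer
  ... | yes x≤n | _ | no-high Σ≤ Σfold≡Σ =
    no-high (+-mono-≤ x≤n Σ≤) (cong₂ _+_ (fold-low x≤n) Σfold≡Σ)
  ... | yes x≤n | _ | one-high o<Σ Σ≡o+Σfold =
    one-high (≤-trans o<Σ (m≤n+m _ x)) (begin
      x + sum xs                            ≡⟨ cong (x +_) Σ≡o+Σfold ⟩
      x + (o + sum (Vec.map fold xs))       ≡⟨ x∙yz≈y∙xz x o _ ⟩
      o + (x + sum (Vec.map fold xs))       ≡⟨ cong (λ z → o + (z + _)) (fold-low x≤n) ⟨
      o + (fold x + sum (Vec.map fold xs))  ∎)
  ... | yes _   | _ | many-high 2o<Σ = many-high (≤-trans 2o<Σ (m≤n+m _ x))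
  ... | no  x≰n | inj₁ x≤n | _ = contradiction x≤n x≰n
  ... | no  x≰n | inj₂ o<x | no-high _ Σfold≡Σ =
    one-high (≤-trans o<x (m≤m+n x _)) (begin
      x + sum xs                            ≡⟨ cong (_+ sum xs) (m+[n∸m]≡n (<⇒≤ o<x)) ⟨
      o + (x ∸ o) + sum xs                  ≡⟨ +-assoc o (x ∸ o) _ ⟩
      o + (x ∸ o + sum xs)                  ≡⟨ cong₂ (λ a b → o + (a + b)) (fold-high x≰n) Σfold≡Σ ⟨
      o + (fold x + sum (Vec.map fold xs))  ∎)
  ... | no  _   | inj₂ o<x | one-high o<Σ _ = many-high (+-mono-≤ o<x o<Σ)
  ... | no  _   | inj₂ _   | many-high 2o<Σ = many-high (≤-trans 2o<Σ (m≤n+m _ x))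

  sum-fold : ∀ {l y} (xs : Vec ℕ l) → n ≤ o → l * n ≤ o → All Outer xs → Outer y → y ≤ o + n
    → sum xs ≡ y → sum (Vec.map fold xs) ≡ fold y
  sum-fold {y = y} xs n≤o ln≤o xs-outer y-outer y≤o+n Σ≡y with sumShape xs xs-outer | y-outer
  ... | no-high _ Σfold≡Σ | inj₁ y≤n = trans Σfold≡Σ (trans Σ≡y (sym (fold-low y≤n)))
  ... | no-high Σ≤ _ | inj₂ o<y =
    contradiction (≤-trans (≤-reflexive (sym Σ≡y)) (≤-trans Σ≤ ln≤o)) (<⇒≱ o<y)
  ... | one-high o<Σ _ | inj₁ y≤n =
    contradiction (≤-trans (subst (_≤ n) (sym Σ≡y) y≤n) n≤o) (<⇒≱ o<Σ)
  ... | one-high _ Σ≡o+Σfold | inj₂ o<y = sym (begin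
      fold y                          ≡⟨ fold-high (λ y≤n → <⇒≱ o<y (≤-trans y≤n n≤o)) ⟩
      y ∸ o                           ≡⟨ cong (_∸ o) (trans (sym Σ≡y) Σ≡o+Σfold) ⟩
      o + sum (Vec.map fold xs) ∸ o   ≡⟨ m+n∸m≡n o _ ⟩
      sum (Vec.map fold xs)           ∎)
  ... | many-high 2o<Σ | _ =
    contradiction (≤-trans (subst (_≤ o + n) (sym Σ≡y) y≤o+n) (+-monoʳ-≤ o n≤o))
                  (<⇒≱ (≤-trans (+-monoʳ-≤ (suc o) (n≤1+n o)) 2o<Σ))

module Blowup (k : ℕ → ℕ) {m q : ℕ} (n : ℕ) (k[m]≡2+q : k m ≡ 2 + q)
              (k≤k[m] : ∀ i → i < m → k i ≤ k m) where

  o : ℕ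
  o = suc q * n + q

  open Fold n o

  n≤o : n ≤ o
  n≤o = ≤-trans (m≤m+n n (q * n)) (m≤m+n (suc q * n) q)

  module _ (c : ℕ → Fin m) where

    colouring : ℕ → Fin (suc m)
    colouring x with x ≤? n | x ≤? o
    ... | yes _ | _     = inject₁ (c x)
    ... | no  _ | yes _ = fromℕ m
    ... | no  _ | no  _ = inject₁ (c (x ∸ o))

    new-colour-middle : ∀ {z} → InColour colouring (blowup q n) (fromℕ m) z → n < z × z ≤ o
    new-colour-middle {z} (_ , _ , col≡new) with z ≤? n | z ≤? o
    ... | yes _   | _       = contradiction (sym col≡new) fromℕ≢inject₁
    ... | no  z≰n | yes z≤o = ≰⇒> z≰n , z≤o
    ... | no  _   | no  _   = contradiction (sym col≡new) fromℕ≢inject₁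

    no-new-colour-solution : ¬ MonoSol colouring (blowup q n) (fromℕ m) (2 + q)
    no-new-colour-solution (xs , y , xs-mid , y-mid , Σ≡y) =
      <⇒≱ o<Σ (subst (_≤ o) (sym Σ≡y) (proj₂ (new-colour-middle y-mid)))
      where
        open ≤-Reasoning
        o<Σ : o < sum xs
        o<Σ = begin-strict
          o                 <⟨ n<1+n o ⟩
          suc o             ≡⟨ +-suc (suc q * n) q ⟨
          suc q * n + suc q ≡⟨ +-comm (suc q * n) (suc q) ⟩
          suc q + suc q * n ≡⟨ *-suc (suc q) n ⟨
          suc q * suc n     ≤⟨ *-≤-sum xs (All.map (proj₁ ∘ new-colour-middle) xs-mid) ⟩
          sum xs            ∎

    old-colour-outer : ∀ {j z} → InColour colouring (blowup q n) (inject₁ j) z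
                     → Outer z × InColour c n j (fold z)
    old-colour-outer {z = z} (1≤z , z≤o+n , col≡j) with z ≤? n | z ≤? o
    ... | yes z-low | _    = inj₁ z-low , 1≤z , z-low , inject₁-injective col≡j
    ... | no  _   | yes _  = contradiction col≡j fromℕ≢inject₁
    ... | no  _   | no z≰o =
      inj₂ (≰⇒> z≰o) ,
      m<n⇒0<n∸m (≰⇒> z≰o) , m≤n+o⇒m∸n≤o z o z≤o+n , inject₁-injective col≡j

    old-colour-solution : ∀ j → MonoSol colouring (blowup q n) (inject₁ j) (k (toℕ j))
                        → MonoSol c n j (k (toℕ j))
    old-colour-solution j (xs , y , xs-j , y-j , Σ≡y) =
      Vec.map fold xs , fold y , gmap (proj₂ ∘ old-colour-outer) xs-j , proj₂ (old-colour-outer y-j) ,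
      sum-fold xs n≤o few-summands (All.map (proj₁ ∘ old-colour-outer) xs-j) (proj₁ (old-colour-outer y-j))
               (proj₁ (proj₂ y-j)) Σ≡y
      where
        few-summands : (k (toℕ j) ∸ 1) * n ≤ o
        few-summands = ≤-trans (*-monoˡ-≤ n (∸-monoˡ-≤ 1 k[j]≤2+q)) (m≤m+n (suc q * n) q)
          where
            k[j]≤2+q = ≤-trans (k≤k[m] (toℕ j) (toℕ<n j)) (≤-reflexive k[m]≡2+q)

  SchurProp-blowup : SchurProp (suc m) (restrict (suc m) k) (blowup q n)
                   → SchurProp m (restrict m k) n
  SchurProp-blowup S c with S (colouring c)
  ... | i , sol with view i
  ... | ‵fromℕ     =
    contradiction (subst (MonoSol (colouring c) _ _) (trans (cong k (toℕ-fromℕ m)) k[m]≡2+q) sol)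
                  (no-new-colour-solution c)
  ... | ‵inject₁ j =
    j , old-colour-solution c j (subst (MonoSol (colouring c) _ _) (cong k (toℕ-inject₁ j)) sol)

SchurProp-blowup : ∀ (k : ℕ → ℕ) {m} n → 2 ≤ k m → (∀ i → i < m → k i ≤ k m)
  → SchurProp (suc m) (restrict (suc m) k) (blowup (k m ∸ 2) n) → SchurProp m (restrict m k) n
SchurProp-blowup k n 2≤k[m] = Blowup.SchurProp-blowup k n (sym (m+[n∸m]≡n 2≤k[m]))

¬SchurProp-pair : ∀ (k : ℕ → ℕ) → 2 ≤ k 0 → k 0 ≤ k 1
  → ¬ SchurProp 2 (restrict 2 k) (blowup (k 1 ∸ 2) (k 0 ∸ 2))
¬SchurProp-pair k 2≤k0 k0≤k1 =
  ¬SchurProp-single (restrict 1 k) (sym (m+[n∸m]≡n 2≤k0))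
  ∘ SchurProp-blowup k (k 0 ∸ 2) (≤-trans 2≤k0 k0≤k1) λ { zero _ → k0≤k1 ; (suc _) (s≤s ()) }

MonotoneBelow : ℕ → (ℕ → ℕ) → Set
MonotoneBelow r k = ∀ i j → i ≤ j → j < r → k i ≤ k j

-- L is one less than the claimed lower bound for S(r); stating its defining identity
-- additively avoids truncated subtraction.
¬SchurProp-iterated-blowup : ∀ {k m r n} → MonotoneBelow r k → 2 ≤ k 0 → m ≤′ r
  → ¬ SchurProp m (restrict m k) n
  → Σ[ L ∈ ℕ ] L + 1 + tailSum k m r ≡ prodRange k m r * suc n × ¬ SchurProp r (restrict r k) L
¬SchurProp-iterated-blowup {k} {m} {n = n} _ _ ≤′-refl ¬S = n , base , ¬S
  where
    base : n + 1 + tailSum k m m ≡ prodRange k m m * suc n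
    base rewrite tailSum-self k m | prodRange-self k m = cong (_+ 0) (+-comm n 1)
¬SchurProp-iterated-blowup {k} {m} {suc r} {n} mono 2≤k0 (≤′-step m≤′r) ¬S
  with L , L+1+T≡P[1+n] , ¬S-L ←
         ¬SchurProp-iterated-blowup (λ i j i≤j j<r → mono i j i≤j (m<n⇒m<1+n j<r)) 2≤k0 m≤′r ¬S =
  blowup q L , L′+1+T′≡P′[1+n] , ¬S-L ∘ SchurProp-blowup k L 2≤k[r] k≤k[r]
  where
    open ≡-Reasoning
    k≤k[r] : ∀ i → i < r → k i ≤ k r
    k≤k[r] i i<r = mono i r (<⇒≤ i<r) ≤-refl
    q = k r ∸ 2
    2≤k[r] : 2 ≤ k r
    2≤k[r] = ≤-trans 2≤k0 (mono 0 r z≤n ≤-refl)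
    k[r]≡2+q : k r ≡ 2 + q
    k[r]≡2+q = sym (m+[n∸m]≡n 2≤k[r])
    L′+1+T′≡P′[1+n] : blowup q L + 1 + tailSum k m (suc r) ≡ prodRange k m (suc r) * suc n
    L′+1+T′≡P′[1+n] = begin
      blowup q L + 1 + tailSum k m (suc r)
        ≡⟨ cong (blowup q L + 1 +_) (tailSum-suc k (≤′⇒≤ m≤′r)) ⟩
      blowup q L + 1 + (tailSum k m r * k r + 1)
        ≡⟨ cong (λ K → blowup q L + 1 + (tailSum k m r * K + 1)) k[r]≡2+q ⟩
      blowup q L + 1 + (tailSum k m r * (2 + q) + 1)
        ≡⟨ blowup-tailSum q L (tailSum k m r) (prodRange k m r) n L+1+T≡P[1+n] ⟩
      prodRange k m r * (2 + q) * suc n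
        ≡⟨ cong (λ K → prodRange k m r * K * suc n) k[r]≡2+q ⟨
      prodRange k m r * k r * suc n
        ≡⟨ cong (_* suc n) (prodRange-suc k (≤′⇒≤ m≤′r)) ⟨
      prodRange k m (suc r) * suc n
        ∎

SchurProp-lowerBound : ∀ (k : ℕ → ℕ) {m r n N} → MonotoneBelow r k → 2 ≤ k 0 → m ≤ r
  → ¬ SchurProp m (restrict m k) n → SchurProp r (restrict r k) N
  → prodRange k m r * suc n ≤ N + tailSum k m r
SchurProp-lowerBound k {m} {r} {n} {N} mono 2≤k0 m≤r ¬S-n S-N
  with L , L+1+T≡P[1+n] , ¬S-L ← ¬SchurProp-iterated-blowup mono 2≤k0 (≤⇒≤′ m≤r) ¬S-n = begin
  prodRange k m r * suc n  ≡⟨ L+1+T≡P[1+n] ⟨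
  L + 1 + tailSum k m r    ≤⟨ +-monoˡ-≤ _ (subst (_≤ N) (+-comm 1 L) L<N) ⟩
  N + tailSum k m r        ∎
  where
    open ≤-Reasoning
    L<N : L < N
    L<N = ¬SchurProp⇒< {K = restrict r k} ¬S-L S-N

IsSchurNumber-lowerBound : ∀ (k : ℕ → ℕ) {m r N M} → MonotoneBelow r k → 2 ≤ k 0 → suc m ≤ r
  → IsSchurNumber r (restrict r k) N → IsSchurNumber (suc m) (restrict (suc m) k) M
  → prodRange k (suc m) r * M ≤ N + tailSum k (suc m) r
IsSchurNumber-lowerBound k {M = zero} _ _ _ _ (() , _)
IsSchurNumber-lowerBound k {m} {M = suc M} mono 2≤k0 m<r (_ , S-N , _) isM =
  SchurProp-lowerBound k mono 2≤k0 m<r ¬S-M S-N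
  where
    ¬S-M : ¬ SchurProp (suc m) (restrict (suc m) k) M
    ¬S-M = IsSchurNumber⇒¬SchurProp-pred {K = restrict (suc m) k} isM

withFirstTwo-≥2 : ∀ {s t k i} → 2 ≤ i → withFirstTwo s t k i ≡ k i
withFirstTwo-≥2 (s≤s (s≤s _)) = refl

withFirstTwo-monotone : ∀ {r s t k} → s ≤ t → t ≤ k 2
  → (∀ i j → 2 ≤ i → i ≤ j → j < r → k i ≤ k j)
  → MonotoneBelow r (withFirstTwo s t k)
withFirstTwo-monotone {r} {s} {t} {k} s≤t t≤k2 mono = monotone
  where
    t≤k : ∀ j → 2 + j < r → t ≤ k (2 + j)
    t≤k j j<r = ≤-trans t≤k2 (mono 2 (2 + j) ≤-refl (s≤s (s≤s z≤n)) j<r)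

    monotone : MonotoneBelow r (withFirstTwo s t k)
    monotone zero          zero          _        _   = ≤-refl
    monotone zero          (suc zero)    _        _   = s≤t
    monotone zero          (suc (suc j)) _        j<r = ≤-trans s≤t (t≤k j j<r)
    monotone (suc zero)    (suc zero)    _        _   = ≤-refl
    monotone (suc zero)    (suc (suc j)) _        j<r = t≤k j j<r
    monotone (suc (suc i)) (suc (suc j)) i≤j      j<r = mono (2 + i) (2 + j) (s≤s (s≤s z≤n)) i≤j j<r
    monotone (suc zero)    zero          ()       _
    monotone (suc (suc _)) zero          ()       _
    monotone (suc (suc _)) (suc zero)    (s≤s ()) _

SchurProp-lowerBound-withFirstTwo : ∀ (k : ℕ → ℕ) {r s t N} → 2 ≤ r → 2 ≤ s → s ≤ t → t ≤ k 2
  → (∀ i j → 2 ≤ i → i ≤ j → j < r → k i ≤ k j)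
  → SchurProp r (restrict r (withFirstTwo s t k)) N
  → prodRange k 2 r * (s * t ∸ t ∸ 1) ≤ N + tailSum k 2 r
SchurProp-lowerBound-withFirstTwo k {r} {s} {t} {N} 2≤r 2≤s s≤t t≤k2 mono S-N = begin
  prodRange k 2 r * (s * t ∸ t ∸ 1)
    ≡⟨ cong₂ _*_ (sym (prodRange-cong 2 r agree)) (st∸t∸1≡1+blowup 2≤s (≤-trans 2≤s s≤t)) ⟩
  prodRange k′ 2 r * suc n
    ≤⟨ SchurProp-lowerBound k′ (withFirstTwo-monotone s≤t t≤k2 mono) 2≤s 2≤r ¬S-n S-N ⟩
  N + tailSum k′ 2 r
    ≡⟨ cong (N +_) (tailSum-cong 2 r agree) ⟩
  N + tailSum k 2 r
    ∎
  where
    open ≤-Reasoning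
    k′ = withFirstTwo s t k
    n = blowup (t ∸ 2) (s ∸ 2)
    agree : ∀ {i} → 2 ≤ i → i < r → k′ i ≡ k i
    agree 2≤i _ = withFirstTwo-≥2 2≤i
    ¬S-n : ¬ SchurProp 2 (restrict 2 k′) n
    ¬S-n = ¬SchurProp-pair k′ 2≤s s≤t

corollary2p3 :
    ((r : ℕ) → 3 ≤ r → (k : ℕ → ℕ) → 3 ≤ k 0
      → (∀ i j → i ≤ j → j < r → k i ≤ k j)
      → (N M : ℕ) → IsSchurNumber r (restrict r k) N → IsSchurNumber 2 (restrict 2 k) M
      → prodRange k 2 r * M ≤ N + sumRange (λ i → prodRange k (i + 1) r) 2 r)
    ×
    ((r : ℕ) → 3 ≤ r → (s t : ℕ) → (k : ℕ → ℕ)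
      → 4 ≤ s → s ≤ t → t ≤ k 2
      → (∀ i j → 2 ≤ i → i ≤ j → j < r → k i ≤ k j)
      → (N : ℕ) → IsSchurNumber r (restrict r (withFirstTwo s t k)) N
      → prodRange k 2 r * (s * t ∸ t ∸ 1) ≤ N + sumRange (λ i → prodRange k (i + 1) r) 2 r)
corollary2p3 =
  (λ r 3≤r k 3≤k0 mono N M isN isM → IsSchurNumber-lowerBound k mono (2≤ 3≤k0) (2≤ 3≤r) isN isM) ,
  (λ r 3≤r s t k 4≤s s≤t t≤k2 mono N (_ , S-N , _) →
     SchurProp-lowerBound-withFirstTwo k (2≤ 3≤r) (2≤ (≤-trans (n≤1+n 3) 4≤s)) s≤t t≤k2 mono S-N)
  where
    2≤ : ∀ {n} → 3 ≤ n → 2 ≤ n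
    2≤ = ≤-trans (n≤1+n 2)
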